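{- Let $S$ be a string of length $n$ ending with the unique end symbol $\$$ and let $k\in[1,n]$. Let $m_k$ be the number of edges (counted with multiplicity) in the edge-reduced de Bruijn graph $\tilde G_k(S)$. Then $m_k=\sum_{\phi\in\mathcal{T}_k(S)} w_k(\phi)$.
   Context: $\Sigma$ is a finite totally ordered alphabet containing a symbol $\$$ smaller than all other symbols; $S$ is a string of length $n$ over $\Sigma$ whose last character is $\$$ and in which $\$$ occurs nowhere else. De Bruijn graph: for $k\in[1,n]$ let $Z_k(S)=S[1..n]S[1..k]$ and $\mathcal{K}=\{Z_k(S)[i..i+k-1]\mid i\in[1,n]\}$. $G_k(S)=(\mathcal{K},E)$ is the directed multigraph with edge multiset $E=\{(x[1..k],x[2..k+1])^m \mid x\in\Sigma^{k+1}\text{ occurs exactly } m\geq1 \text{ times in } Z_k(S)\}$ ($m$ = multiplicity). Edge-reduced de Bruijn graph: let $F=\{(x,y)^m\in E\mid y \text{ is the only successor of } x \text{ and } x \text{ is the only predecessor of } y\}$; then $\tilde G_k(S)=(\mathcal{K},\tilde E)$ with $\tilde E=(E\setminus F)\uplus\{(x,y)^1\mid (x,y)^m\in F\}$. Its number of edges is $\sum_{(x,y)^m\in\tilde E} m$. Rotation-trie: $\mathcal{T}(S)$ is the trie of the $n$ (distinct) rotations $S[i..n]S[1..i-1]$ of $S$, children ordered by lexicographic order of labels; $l(\phi)$ is the root-to-$\phi$ label; $\mathcal{T}_k(S)$ is the set of nodes at level $k$ (label length $k$); $|\phi|$ is the number of leaves in the subtree rooted at $\phi$. Weiner links: $(\phi,\varphi,c)$,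 $c\in\Sigma$, is a Weiner link of $\phi$ if $l(\varphi)=c\,l(\phi)$, or $|l(\phi)|=n$ and $l(\varphi)=c\,l(\phi)[1..n-1]$; it is unique if $\phi$ has no other Weiner link $(\phi,\psi,d)$ with $\psi\neq\varphi$. Weights: for $\phi\in\mathcal{T}_k(S)$, $w_k(\phi)=1$ if $\phi$ has a unique Weiner link $(\phi,\varphi,c)$ and $\varphi$ has no siblings; otherwise $w_k(\phi)=|\phi|$. -}

module Defs where

open import Data.Nat using (ℕ; zero; suc; _+_; _∸_; _≟_)
open import Data.Fin using (Fin)
open import Data.Nat.ListAction using (sum)
import Data.Fin as Fin
open import Data.Bool using (Bool; true; false; if_then_else_)
open import Data.List using (List; []; _∷_; [_]; _++_; take; drop; length; map; upTo;
  filter; deduplicate; allFin; concatMap)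
open import Data.List.Properties using (≡-dec)
open import Data.List.Relation.Unary.All using (All; all?)
open import Data.List.Relation.Unary.Any using (Any; any?)
open import Data.List.Membership.Propositional using (_∉_)
open import Data.Product using (Σ; _×_)
open import Relation.Nullary using (does; _×-dec_)
open import Relation.Binary.PropositionalEquality using (_≡_)

-- Alphabet Σ = Fin (suc σ) (finite, totally ordered); the end symbol $ is its least element.
Alph : ℕ → Set
Alph σ = Fin (suc σ)

Str : ℕ → Set
Str σ = List (Alph σ)

$ : ∀ {σ} → Alph σ
$ = Fin.zero

DollarTerminated : ∀ {σ} → Str σ → Set
DollarTerminated {σ} S = Σ (Str σ) λ T → (S ≡ T ++ [ $ ]) × ($ ∉ T)

module _ {σ : ℕ} where

  private
    _≟s_ = ≡-dec (Fin._≟_ {suc σ})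

  -- de Bruijn graph side (positions are 0-based)

  Zk : Str σ → ℕ → Str σ
  Zk S k = S ++ take k S

  -- all occurrences of (k+1)-substrings of Z_k(S): Z_k(S)[i..i+k] for i ∈ [0, n-1]
  -- (these are all the positions at which a (k+1)-substring fits, |Z_k(S)| = n + k)
  occurrences : Str σ → ℕ → List (Str σ)
  occurrences S k = map (λ i → take (suc k) (drop i (Zk S k))) (upTo (length S))

  multiplicity : Str σ → ℕ → Str σ → ℕ
  multiplicity S k x = length (filter (λ y → y ≟s x) (occurrences S k))

  -- the distinct x ∈ Σ^{k+1} occurring in Z_k(S); each gives edge (x[1..k], x[2..k+1])^m
  edgeWords : Str σ → ℕ → List (Str σ)
  edgeWords S k = deduplicate _≟s_ (occurrences S k)

  source : ℕ → Str σ → Str σ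
  source k x = take k x

  target : Str σ → Str σ
  target x = drop 1 x

  successors : Str σ → ℕ → Str σ → List (Str σ)
  successors S k u = map target (filter (λ x → source k x ≟s u) (edgeWords S k))

  predecessors : Str σ → ℕ → Str σ → List (Str σ)
  predecessors S k v = map (source k) (filter (λ x → target x ≟s v) (edgeWords S k))

  inF : Str σ → ℕ → Str σ → Bool
  inF S k x = does (all? (λ y → y ≟s target x) (successors S k (source k x))
                    ×-dec all? (λ y → y ≟s source k x) (predecessors S k (target x)))

  reducedEdgeCount : Str σ → ℕ → ℕ
  reducedEdgeCount S k =
    sum (map (λ x → if inF S k x then 1 else multiplicity S k x) (edgeWords S k))

  -- rotation trie side; a node is identified with its label l(φ)

  rotation : Str σ → ℕ → Str σ
  rotation S i = drop i S ++ take i S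

  rotations : Str σ → List (Str σ)
  rotations S = map (rotation S) (upTo (length S))

  -- v is (the label of) a node of T(S): a prefix of some rotation
  isNode? : (S : Str σ) → (v : Str σ) → _
  isNode? S v = any? (λ r → take (length v) r ≟s v) (rotations S)

  levelNodes : Str σ → ℕ → List (Str σ)
  levelNodes S j = deduplicate _≟s_ (map (take j) (rotations S))

  -- |φ| : number of leaves (= rotations) in the subtree of the node with label u
  leafCount : Str σ → Str σ → ℕ
  leafCount S u = length (filter (λ r → take (length u) r ≟s u) (rotations S))

  weinerCandidates : Str σ → Str σ → List (Str σ)
  weinerCandidates S u = concatMap (λ c → (c ∷ u) ∷ extra c) (allFin (suc σ))
    where
    extra : Alph σ → List (Str σ)
    extra c = if does (length u ≟ length S) then [ c ∷ take (length S ∸ 1) u ] else []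

  weinerTargets : Str σ → Str σ → List (Str σ)
  weinerTargets S u = deduplicate _≟s_ (filter (isNode? S) (weinerCandidates S u))

  noSiblings : Str σ → Str σ → Bool
  noSiblings S v = does (all? (λ v' → v' ≟s v)
    (filter (λ v' → take (length v ∸ 1) v' ≟s take (length v ∸ 1) v) (levelNodes S (length v))))

  weight : Str σ → Str σ → ℕ
  weight S u with weinerTargets S u
  ... | v ∷ [] = if noSiblings S v then 1 else leafCount S u
  ... | _      = leafCount S u

-- Write n = |S| and let r_i = S[i..n]S[1..i-1] be the rotations of S.
--
-- Case k < n.  The length-(k+1) window of Z_k(S) at position i is the prefix
-- of length k+1 of r_i, so the edge words of G_k(S) are exactly the trie nodes
-- of level k+1, and the target of the window at i is the length-k prefix of
-- r_{i+1}.  Since i ↦ i+1 permutes the positions cyclically, the targets of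
-- all windows are the length-k prefixes of all rotations.  Grouping the edges
-- by their target u ∈ T_k(S):
--   * the edges into u are the Weiner-link targets c·u of u, and their
--     multiplicities add up to |u| (the number of rotations with prefix u);
--   * if u has two or more of them, none of them lies in F (u has two
--     predecessors), so they contribute |u| = w_k(u);
--   * if u has exactly one, v = c·u, then v ∈ F iff v has no sibling in the
--     trie, which is exactly the case distinction defining w_k(u).
-- Case k = n.  Since $ occurs once in S, the n rotations are pairwise distinct,
-- so every window occurs once and every level-n node has a single leaf: both
-- sides equal n.

module Submission where

open import Data.Nat using (ℕ; zero; suc; _+_; _∸_; _≤_; _<_; _⊓_; z≤n; s≤s; _≟_)
open import Data.Nat.Properties
open import Data.Nat.ListAction using (sum)
open import Algebra.Properties.CommutativeSemigroup +-commutativeSemigroup using (interchange)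
open import Data.Bool using (Bool; true; false; if_then_else_)
import Data.Fin as Fin
open import Data.List using (List; []; _∷_; [_]; _++_; take; drop; length; map; filter; deduplicate;
  upTo; applyUpTo; allFin)
open import Data.List.Properties using (≡-dec; map-∘; map-id; map-cong-local; map-upTo; applyUpTo-∷ʳ;
  length-take; length-drop; length-++; length-map; length-upTo; take-[]; take-take; take-all; drop-all;
  ++-assoc; ++-identityʳ; ∷-injectiveˡ; ∷-injectiveʳ; filter-all; filter-none)
open import Data.List.Membership.Propositional using (_∈_; _∉_; find)
open import Data.List.Membership.Propositional.Properties using (∈-map⁺; ∈-map⁻; ∈-filter⁺; ∈-filter⁻;
  ∈-deduplicate⁺; ∈-deduplicate⁻; ∈-upTo⁺; ∈-upTo⁻; ∈-concatMap⁺; ∈-concatMap⁻; ∈-allFin)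
open import Data.List.Relation.Unary.Any using (Any; here; there)
import Data.List.Relation.Unary.Any as Any
open import Data.List.Relation.Unary.All using (All; []; _∷_; all?)
import Data.List.Relation.Unary.All as All
open import Data.List.Relation.Unary.AllPairs using ([]; _∷_)
open import Data.List.Relation.Unary.Unique.Propositional using (Unique)
import Data.List.Relation.Unary.Unique.Propositional.Properties as Unique
open import Data.List.Relation.Unary.Unique.DecPropositional.Properties using (deduplicate-!)
open import Data.List.Relation.Binary.Permutation.Propositional using (_↭_; ↭-sym)
open import Data.List.Relation.Binary.Permutation.Propositional.Properties using (∈-resp-↭; filter-↭;
  ↭-length; ∷↭∷ʳ)
open import Data.Product using (Σ; _×_; _,_; proj₁; proj₂)
open import Data.Sum using (_⊎_; inj₁; inj₂)
open import Data.Empty using (⊥-elim)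
open import Function using (_∘_)
open import Relation.Nullary using (Dec; yes; no; does; ¬?; _×-dec_)
open import Relation.Nullary.Decidable using (dec-false)
open import Relation.Binary.Definitions using (DecidableEquality)
open import Relation.Binary.PropositionalEquality hiding ([_])

open import Defs

-- Sums over lists

sum-map-cong : ∀ {A : Set} (xs : List A) {f g : A → ℕ} → (∀ {x} → x ∈ xs → f x ≡ g x) →
  sum (map f xs) ≡ sum (map g xs)
sum-map-cong xs eq = cong sum (map-cong-local (All.tabulate eq))

sum-map-1 : ∀ {A : Set} (xs : List A) → sum (map (λ _ → 1) xs) ≡ length xs
sum-map-1 [] = refl
sum-map-1 (_ ∷ xs) = cong suc (sum-map-1 xs)

sum-map-+ : ∀ {A : Set} (xs : List A) (f g : A → ℕ) →
  sum (map (λ x → f x + g x) xs) ≡ sum (map f xs) + sum (map g xs)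
sum-map-+ [] f g = refl
sum-map-+ (x ∷ xs) f g = trans (cong (f x + g x +_) (sum-map-+ xs f g)) (interchange (f x) (g x) _ _)

module Fibres {A B : Set} (_≟B_ : DecidableEquality B) (h : A → B) (g : A → ℕ) where

  fibreSum : List A → B → ℕ
  fibreSum xs u = sum (map g (filter (λ y → h y ≟B u) xs))

  indicator : B → B → ℕ → ℕ
  indicator b u v = if does (b ≟B u) then v else 0

  fibreSum-∷ : ∀ x xs u → fibreSum (x ∷ xs) u ≡ indicator (h x) u (g x) + fibreSum xs u
  fibreSum-∷ x xs u with h x ≟B u
  ... | yes _ = refl
  ... | no _ = refl

  indicator-absent : ∀ (U : List B) b v → All (b ≢_) U → sum (map (λ u → indicator b u v) U) ≡ 0
  indicator-absent [] b v _ = refl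
  indicator-absent (u ∷ U) b v (b≢u ∷ b∉U) with b ≟B u
  ... | yes b≡u = ⊥-elim (b≢u b≡u)
  ... | no _ = indicator-absent U b v b∉U

  indicator-once : ∀ (U : List B) → Unique U → ∀ b v → b ∈ U → sum (map (λ u → indicator b u v) U) ≡ v
  indicator-once (u ∷ U) (u∉U ∷ _) b v (here refl) with b ≟B b
  ... | no b≢b = ⊥-elim (b≢b refl)
  ... | yes _ = trans (cong (v +_) (indicator-absent U b v u∉U)) (+-identityʳ v)
  indicator-once (u ∷ U) (u∉U ∷ U!) b v (there b∈U) with b ≟B u
  ... | yes refl = ⊥-elim (All.lookup u∉U b∈U refl)
  ... | no _ = indicator-once U U! b v b∈U

  sum-by-fibres : ∀ (U : List B) → Unique U → (xs : List A) → (∀ {x} → x ∈ xs → h x ∈ U) →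
    sum (map g xs) ≡ sum (map (fibreSum xs) U)
  sum-by-fibres U U! [] _ = sym (zeros U)
    where
    zeros : ∀ (V : List B) → sum (map (fibreSum []) V) ≡ 0
    zeros [] = refl
    zeros (_ ∷ V) = zeros V
  sum-by-fibres U U! (x ∷ xs) hxs∈U = begin
    g x + sum (map g xs)
      ≡⟨ cong₂ _+_ (sym (indicator-once U U! (h x) (g x) (hxs∈U (here refl))))
                   (sum-by-fibres U U! xs (hxs∈U ∘ there)) ⟩
    sum (map (λ u → indicator (h x) u (g x)) U) + sum (map (fibreSum xs) U)
      ≡⟨ sym (sum-map-+ U _ _) ⟩
    sum (map (λ u → indicator (h x) u (g x) + fibreSum xs u) U)
      ≡⟨ sum-map-cong U (λ {u} _ → sym (fibreSum-∷ x xs u)) ⟩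
    sum (map (fibreSum (x ∷ xs)) U) ∎
    where open ≡-Reasoning

-- Filtering, counting and deduplication

module _ {A B : Set} {P : B → Set} (P? : (b : B) → Dec (P b)) (f : A → B) where

  length-filter-map : ∀ xs → length (filter P? (map f xs)) ≡ length (filter (P? ∘ f) xs)
  length-filter-map [] = refl
  length-filter-map (x ∷ xs) with does (P? (f x))
  ... | true = cong suc (length-filter-map xs)
  ... | false = length-filter-map xs

module _ {A : Set} {P Q : A → Set} (P? : (a : A) → Dec (P a)) (Q? : (a : A) → Dec (Q a)) where

  filter-filter-stronger : (∀ {y} → P y → Q y) → ∀ xs → filter P? (filter Q? xs) ≡ filter P? xs
  filter-filter-stronger P⇒Q [] = refl
  filter-filter-stronger P⇒Q (x ∷ xs) with Q? x
  ... | yes _ with P? x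
  ...   | yes _ = cong (x ∷_) (filter-filter-stronger P⇒Q xs)
  ...   | no _ = filter-filter-stronger P⇒Q xs
  filter-filter-stronger P⇒Q (x ∷ xs) | no ¬q with P? x
  ...   | yes p = ⊥-elim (¬q (P⇒Q p))
  ...   | no _ = filter-filter-stronger P⇒Q xs

module _ {A : Set} (_≟A_ : DecidableEquality A) where

  deduplicate-unique : ∀ (xs : List A) → Unique xs → deduplicate _≟A_ xs ≡ xs
  deduplicate-unique [] _ = refl
  deduplicate-unique (x ∷ xs) (x∉xs ∷ xs!) rewrite deduplicate-unique xs xs! =
    cong (x ∷_) (filter-all (λ y → ¬? (x ≟A y)) x∉xs)

  count-unique : ∀ (xs : List A) {x} → Unique xs → x ∈ xs → length (filter (_≟A x) xs) ≡ 1
  count-unique (y ∷ xs) (y∉xs ∷ _) (here refl) with y ≟A y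
  ... | no y≢y = ⊥-elim (y≢y refl)
  ... | yes _ = cong (suc ∘ length) (filter-none (_≟A y) (All.map (λ y≢z z≡y → y≢z (sym z≡y)) y∉xs))
  count-unique (y ∷ xs) {x} (y∉xs ∷ xs!) (there x∈xs) with y ≟A x
  ... | yes refl = ⊥-elim (All.lookup y∉xs x∈xs refl)
  ... | no _ = count-unique xs xs! x∈xs

unique-singleton : ∀ {A : Set} (L : List A) v → Unique L → (∀ {x} → x ∈ L → x ≡ v) → v ∈ L → L ≡ [ v ]
unique-singleton (x ∷ []) v _ all≡v _ = cong [_] (all≡v (here refl))
unique-singleton (x ∷ y ∷ L) v ((x≢y ∷ _) ∷ _) all≡v _ =
  ⊥-elim (x≢y (trans (all≡v (here refl)) (sym (all≡v (there (here refl))))))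

unique-another : ∀ {A : Set} (L : List A) {x} → Unique L → x ∈ L → (∀ v → L ≢ [ v ]) →
  Σ A λ w → w ∈ L × w ≢ x
unique-another (y ∷ []) _ _ notSingleton = ⊥-elim (notSingleton y refl)
unique-another (y ∷ z ∷ L) ((y≢z ∷ _) ∷ _) (here refl) _ = z , there (here refl) , y≢z ∘ sym
unique-another (y ∷ z ∷ L) ((y≢z ∷ y∉L) ∷ _) (there x∈) _ = y , here refl , λ { refl → y∉tail x∈ }
  where
  y∉tail : y ∉ z ∷ L
  y∉tail (here y≡z) = y≢z y≡z
  y∉tail (there y∈L) = All.lookup y∉L y∈L refl

does-⇔ : ∀ {P Q : Set} (P? : Dec P) (Q? : Dec Q) → (P → Q) → (Q → P) → does P? ≡ does Q?
does-⇔ (yes _) (yes _) _ _ = refl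
does-⇔ (yes p) (no ¬q) P⇒Q _ = ⊥-elim (¬q (P⇒Q p))
does-⇔ (no ¬p) (yes q) _ Q⇒P = ⊥-elim (¬p (Q⇒P q))
does-⇔ (no _) (no _) _ _ = refl

if-then-1 : ∀ (b : Bool) m → m ≡ 1 → (if b then 1 else m) ≡ 1
if-then-1 true m _ = refl
if-then-1 false m m≡1 = m≡1

-- Rotations of a list

module Rotations {A : Set} where

  rot : List A → ℕ → List A
  rot xs i = drop i xs ++ take i xs

  take-++-agree : ∀ m (X Y Y' : List A) → take (m ∸ length X) Y ≡ take (m ∸ length X) Y' →
    take m (X ++ Y) ≡ take m (X ++ Y')
  take-++-agree m [] Y Y' eq = eq
  take-++-agree zero (x ∷ X) Y Y' eq = refl
  take-++-agree (suc m) (x ∷ X) Y Y' eq = cong (x ∷_) (take-++-agree m X Y Y' eq)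

  take-take-≤ : ∀ {t a} (xs : List A) → t ≤ a → take t (take a xs) ≡ take t xs
  take-take-≤ {t} {a} xs t≤a = trans (take-take t a xs) (cong (λ z → take z xs) (m≤n⇒m⊓n≡m t≤a))

  take-prefixes : ∀ {t a b} (xs : List A) → t ≤ a → t ≤ b → take t (take a xs) ≡ take t (take b xs)
  take-prefixes xs t≤a t≤b = trans (take-take-≤ xs t≤a) (sym (take-take-≤ xs t≤b))

  drop-++ˡ : ∀ i (X Y : List A) → i ≤ length X → drop i (X ++ Y) ≡ drop i X ++ Y
  drop-++ˡ zero X Y _ = refl
  drop-++ˡ (suc i) (x ∷ X) Y (s≤s i≤) = drop-++ˡ i X Y i≤

  drop-∷ : ∀ i (xs : List A) → i < length xs →
    Σ A λ a → drop i xs ≡ a ∷ drop (suc i) xs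
  drop-∷ zero (x ∷ xs) _ = x , refl
  drop-∷ (suc i) (x ∷ xs) (s≤s i<) = drop-∷ i xs i<

  length-rot : ∀ (xs : List A) i → i ≤ length xs → length (rot xs i) ≡ length xs
  length-rot xs i i≤ = begin
    length (drop i xs ++ take i xs)          ≡⟨ length-++ (drop i xs) ⟩
    length (drop i xs) + length (take i xs)  ≡⟨ cong₂ _+_ (length-drop i xs) (length-take i xs) ⟩
    (length xs ∸ i) + (i ⊓ length xs)        ≡⟨ cong ((length xs ∸ i) +_) (m≤n⇒m⊓n≡m i≤) ⟩
    (length xs ∸ i) + i                      ≡⟨ m∸n+n≡m i≤ ⟩
    length xs                                ∎
    where open ≡-Reasoning

  rot-length : ∀ (xs : List A) → rot xs (length xs) ≡ rot xs 0
  rot-length xs = trans (cong₂ _++_ (drop-all (length xs) xs ≤-refl) (take-all (length xs) xs ≤-refl))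
                        (sym (++-identityʳ xs))

  window-rot : ∀ (xs : List A) k i → k < length xs → i < length xs →
    take (suc k) (drop i (xs ++ take k xs)) ≡ take (suc k) (rot xs i)
  window-rot xs k i k<n i<n =
    trans (cong (take (suc k)) (drop-++ˡ i xs (take k xs) (<⇒≤ i<n)))
          (take-++-agree (suc k) (drop i xs) (take k xs) (take i xs) (take-prefixes xs t≤k t≤i))
    where
    n = length xs
    t = suc k ∸ length (drop i xs)
    |drop| : length (drop i xs) ≡ n ∸ i
    |drop| = length-drop i xs
    t≤k : t ≤ k
    t≤k = ∸-monoʳ-≤ (suc k) (subst (1 ≤_) (sym |drop|) (m<n⇒0<n∸m i<n))
    t≤i : t ≤ i
    t≤i = ≤-trans (∸-monoˡ-≤ (length (drop i xs)) k<n)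
                  (≤-reflexive (trans (cong (n ∸_) |drop|) (m∸[m∸n]≡n (<⇒≤ i<n))))

  drop1-take : ∀ k (r : List A) → drop 1 (take (suc k) r) ≡ take k (drop 1 r)
  drop1-take k [] = sym (take-[] k)
  drop1-take k (x ∷ r) = refl

  shift-rot : ∀ (xs : List A) k i → k < length xs → i < length xs →
    take k (drop 1 (rot xs i)) ≡ take k (rot xs (suc i))
  shift-rot xs k i k<n i<n with drop-∷ i xs i<n
  ... | a , drop≡ rewrite drop≡ =
    take-++-agree k (drop (suc i) xs) (take i xs) (take (suc i) xs) (take-prefixes xs t≤i (≤-trans t≤i (n≤1+n i)))
    where
    r = drop (suc i) xs
    t≤i : k ∸ length r ≤ i
    t≤i = m≤n+o⇒m∸n≤o k (length r) (≤-pred (≤-trans k<n (≤-reflexive (sym (begin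
      suc (length r + i)  ≡⟨ sym (+-suc (length r) i) ⟩
      length r + suc i    ≡⟨ cong (_+ suc i) (length-drop (suc i) xs) ⟩
      length xs ∸ suc i + suc i ≡⟨ m∸n+n≡m i<n ⟩
      length xs ∎)))))
      where open ≡-Reasoning

shift-↭ : ∀ {B : Set} (g : ℕ → B) m → g (suc m) ≡ g 0 →
  map (g ∘ suc) (upTo (suc m)) ↭ map g (upTo (suc m))
shift-↭ g m periodic rewrite map-upTo (g ∘ suc) (suc m) | map-upTo g (suc m)
  | sym (applyUpTo-∷ʳ (g ∘ suc) m) | periodic = ↭-sym (∷↭∷ʳ (g 0) (applyUpTo (g ∘ suc) m))

module Delimited {A : Set} (d : A) where

  open Rotations

  marker-position : ∀ (X X' Y Y' : List A) → d ∉ X → d ∉ X' → X ++ d ∷ Y ≡ X' ++ d ∷ Y' →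
    length X ≡ length X'
  marker-position [] [] Y Y' _ _ _ = refl
  marker-position [] (x' ∷ X') Y Y' _ d∉X' eq = ⊥-elim (d∉X' (here (∷-injectiveˡ eq)))
  marker-position (x ∷ X) [] Y Y' d∉X _ eq = ⊥-elim (d∉X (here (sym (∷-injectiveˡ eq))))
  marker-position (x ∷ X) (x' ∷ X') Y Y' d∉X d∉X' eq =
    cong suc (marker-position X X' Y Y' (d∉X ∘ there) (d∉X' ∘ there) (∷-injectiveʳ eq))

  ∉-drop : ∀ i (xs : List A) → d ∉ xs → d ∉ drop i xs
  ∉-drop zero xs d∉ = d∉
  ∉-drop (suc i) [] d∉ = d∉
  ∉-drop (suc i) (x ∷ xs) d∉ = ∉-drop i xs (d∉ ∘ there)

  rot-marked : ∀ (T : List A) i → i ≤ length T →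
    rot (T ++ [ d ]) i ≡ drop i T ++ d ∷ take i (T ++ [ d ])
  rot-marked T i i≤ = trans (cong (_++ take i (T ++ [ d ])) (drop-++ˡ i T [ d ] i≤))
                            (++-assoc (drop i T) [ d ] (take i (T ++ [ d ])))

  rot-injective : ∀ (S T : List A) → S ≡ T ++ [ d ] → d ∉ T → ∀ i j → i < length S → j < length S →
    rot S i ≡ rot S j → i ≡ j
  rot-injective S T refl d∉T i j i< j< eq =
    ∸-cancelˡ-≡ i≤ j≤ (trans (sym (length-drop i T)) (trans same-position (length-drop j T)))
    where
    |S| : length (T ++ [ d ]) ≡ suc (length T)
    |S| = trans (length-++ T) (+-comm (length T) 1)
    i≤ : i ≤ length T
    i≤ = ≤-pred (subst (suc i ≤_) |S| i<)
    j≤ : j ≤ length T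
    j≤ = ≤-pred (subst (suc j ≤_) |S| j<)
    same-position : length (drop i T) ≡ length (drop j T)
    same-position = marker-position (drop i T) (drop j T) _ _ (∉-drop i T d∉T) (∉-drop j T d∉T)
      (trans (sym (rot-marked T i i≤)) (trans eq (rot-marked T j j≤)))

open Rotations

weight-cases : ∀ {σ} (S : Str σ) u →
  (Σ (Str σ) λ v → (weinerTargets S u ≡ [ v ]) × (weight S u ≡ (if noSiblings S v then 1 else leafCount S u)))
  ⊎ ((∀ v → weinerTargets S u ≢ [ v ]) × (weight S u ≡ leafCount S u))
weight-cases S u with weinerTargets S u
... | [] = inj₂ ((λ v ()) , refl)
... | v ∷ [] = inj₁ (v , refl , refl)
... | v ∷ w ∷ r = inj₂ ((λ v ()) , refl)

module EdgeCount {σ : ℕ} (S : Str σ) where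

  _≟s_ : DecidableEquality (Str σ)
  _≟s_ = ≡-dec (Fin._≟_ {suc σ})

  n : ℕ
  n = length S

  rots : List (Str σ)
  rots = rotations S

  levelNodes⁻ : ∀ {x} j → x ∈ levelNodes S j → Σ ℕ λ i → i < n × x ≡ take j (rotation S i)
  levelNodes⁻ j x∈ with ∈-map⁻ (take j) (∈-deduplicate⁻ _≟s_ _ x∈)
  ... | r , r∈ , refl with ∈-map⁻ (rotation S) r∈
  ... | i , i∈ , refl = i , ∈-upTo⁻ i∈ , refl

  levelNodes⁺ : ∀ j i → i < n → take j (rotation S i) ∈ levelNodes S j
  levelNodes⁺ j i i< = ∈-deduplicate⁺ _≟s_ (∈-map⁺ (take j) (∈-map⁺ (rotation S) (∈-upTo⁺ i<)))

  length-take-rot : ∀ j i → j ≤ n → i < n → length (take j (rotation S i)) ≡ j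
  length-take-rot j i j≤ i< = trans (length-take j (rotation S i))
    (trans (cong (j ⊓_) (length-rot S i (<⇒≤ i<))) (m≤n⇒m⊓n≡m j≤))

  -- 1 ≤ k < n: group the edges by their target vertex
  module BelowLength (k : ℕ) (1≤k : 1 ≤ k) (k<n : k < n) where

    occ E U : List (Str σ)
    occ = occurrences S k
    E = edgeWords S k
    U = levelNodes S k

    occ≡prefixes : occ ≡ map (take (suc k)) rots
    occ≡prefixes = trans (map-cong-local (All.tabulate λ i∈ → window-rot S k _ k<n (∈-upTo⁻ i∈)))
                         (map-∘ (upTo n))

    E≡level : E ≡ levelNodes S (suc k)
    E≡level = cong (deduplicate _≟s_) occ≡prefixes

    targets↭prefixes : map target occ ↭ map (take k) rots
    targets↭prefixes = subst₂ _↭_ (sym targets≡shifted) (map-∘ (upTo n)) (shifted n refl (≤-trans (s≤s z≤n) k<n))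
      where
      prefix : ℕ → Str σ
      prefix i = take k (rotation S i)
      targets≡shifted : map target occ ≡ map (prefix ∘ suc) (upTo n)
      targets≡shifted = trans (sym (map-∘ (upTo n))) (map-cong-local (All.tabulate λ {i} i∈ →
        trans (cong target (window-rot S k i k<n (∈-upTo⁻ i∈)))
              (trans (drop1-take k (rot S i)) (shift-rot S k i k<n (∈-upTo⁻ i∈)))))
      shifted : ∀ m → m ≡ n → 0 < m → map (prefix ∘ suc) (upTo m) ↭ map prefix (upTo m)
      shifted (suc m) m≡n _ = shift-↭ prefix m (cong (take k) (trans (cong (rot S) m≡n) (rot-length S)))

    E⁻ : ∀ {x} → x ∈ E → Σ ℕ λ i → i < n × x ≡ take (suc k) (rotation S i)
    E⁻ {x} x∈ = levelNodes⁻ (suc k) (subst (x ∈_) E≡level x∈)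

    E⁺ : ∀ i → i < n → take (suc k) (rotation S i) ∈ E
    E⁺ i i< = subst (take (suc k) (rotation S i) ∈_) (sym E≡level) (levelNodes⁺ (suc k) i i<)

    length-E : ∀ {x} → x ∈ E → length x ≡ suc k
    length-E x∈ with E⁻ x∈
    ... | i , i< , refl = length-take-rot (suc k) i k<n i<

    length-U : ∀ {u} → u ∈ U → length u ≡ k
    length-U u∈ with levelNodes⁻ k u∈
    ... | i , i< , refl = length-take-rot k i (<⇒≤ k<n) i<

    target∈U : ∀ {x} → x ∈ E → target x ∈ U
    target∈U x∈ = ∈-deduplicate⁺ _≟s_ (∈-resp-↭ targets↭prefixes (∈-map⁺ target (∈-deduplicate⁻ _≟s_ occ x∈)))

    edge-ext : ∀ {x y} → x ∈ E → y ∈ E → source k x ≡ source k y → target x ≡ target y → x ≡ y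
    edge-ext {x} {y} x∈ y∈ = ext k 1≤k x y (length-E x∈) (length-E y∈)
      where
      ext : ∀ j → 1 ≤ j → ∀ x y → length x ≡ suc k → length y ≡ suc k →
        take j x ≡ take j y → drop 1 x ≡ drop 1 y → x ≡ y
      ext (suc j) _ (a ∷ x) (b ∷ y) _ _ heads tails = cong₂ _∷_ (∷-injectiveˡ heads) tails

    into : Str σ → List (Str σ)
    into u = filter (λ x → target x ≟s u) E

    into⁻ : ∀ {u x} → x ∈ into u → x ∈ E × target x ≡ u
    into⁻ {u} {x} x∈ = ∈-filter⁻ (λ y → target y ≟s u) {x} {E} x∈

    into-unique : ∀ u → Unique (into u)
    into-unique u = Unique.filter⁺ (λ x → target x ≟s u) (deduplicate-! _≟s_ occ)

    into-nonempty : ∀ {u} → u ∈ U → Σ (Str σ) λ x → x ∈ into u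
    into-nonempty {u} u∈ with ∈-map⁻ target (∈-resp-↭ (↭-sym targets↭prefixes) (∈-deduplicate⁻ _≟s_ _ u∈))
    ... | x , x∈ , refl = x , ∈-filter⁺ (λ y → target y ≟s target x) (∈-deduplicate⁺ _≟s_ x∈) refl

    into-multiplicity : ∀ {u} → u ∈ U → sum (map (multiplicity S k) (into u)) ≡ leafCount S u
    into-multiplicity {u} u∈ = begin
      sum (map (multiplicity S k) (into u))
        ≡⟨ sum-map-cong (into u) count-in-windows ⟨
      sum (map (fibreSum windows) (into u))
        ≡⟨ sum-by-fibres (into u) (into-unique u) windows windows⊆into ⟨
      sum (map (λ _ → 1) windows)
        ≡⟨ sum-map-1 windows ⟩
      length windows
        ≡⟨ length-filter-map (_≟s u) target occ ⟨
      length (filter (_≟s u) (map target occ))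
        ≡⟨ ↭-length (filter-↭ (_≟s u) targets↭prefixes) ⟩
      length (filter (_≟s u) (map (take k) rots))
        ≡⟨ length-filter-map (_≟s u) (take k) rots ⟩
      length (filter (λ r → take k r ≟s u) rots)
        ≡⟨ cong (λ j → length (filter (λ r → take j r ≟s u) rots)) (length-U u∈) ⟨
      leafCount S u ∎
      where
      open ≡-Reasoning
      open Fibres _≟s_ (λ y → y) (λ _ → 1)
      windows : List (Str σ)
      windows = filter (λ y → target y ≟s u) occ
      windows⊆into : ∀ {y} → y ∈ windows → y ∈ into u
      windows⊆into {y} y∈ with ∈-filter⁻ (λ y → target y ≟s u) {y} {occ} y∈
      ... | y∈occ , ty = ∈-filter⁺ (λ x → target x ≟s u) (∈-deduplicate⁺ _≟s_ y∈occ) ty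
      count-in-windows : ∀ {x} → x ∈ into u → fibreSum windows x ≡ multiplicity S k x
      count-in-windows {x} x∈ = trans (sum-map-1 (filter (_≟s x) windows)) (cong length
        (filter-filter-stronger (_≟s x) (λ y → target y ≟s u) (λ { refl → proj₂ (into⁻ x∈) }) occ))

    letterCandidates : Str σ → Alph σ → List (Str σ)
    letterCandidates u c = (c ∷ u) ∷ (if does (length u ≟ length S) then [ c ∷ take (length S ∸ 1) u ] else [])

    into⊆weiner : ∀ {u x} → u ∈ U → x ∈ into u → x ∈ weinerTargets S u
    into⊆weiner {u} {x} u∈ x∈ with into⁻ x∈
    ... | x∈E , refl with E⁻ x∈E | length-E x∈E
    ... | i , i< , x≡ | |x| = ∈-deduplicate⁺ _≟s_ (∈-filter⁺ (isNode? S) candidate isNode)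
      where
      candidate : x ∈ weinerCandidates S (target x)
      candidate = letter-then-target x |x|
        where
        letter-then-target : ∀ y → length y ≡ suc k → y ∈ weinerCandidates S (target y)
        letter-then-target (c ∷ y) _ = ∈-concatMap⁺ (letterCandidates y) (Any.map (λ { refl → here refl }) (∈-allFin c))
      isNode : Any (λ r → take (length x) r ≡ x) rots
      isNode = Any.map (λ { refl → trans (cong (λ j → take j (rotation S i)) |x|) (sym x≡) })
                       (∈-map⁺ (rotation S) (∈-upTo⁺ i<))

    -- (the extra candidates c·l(φ)[1..n-1] do not arise, as |u| = k < n)
    weiner⊆into : ∀ {u v} → u ∈ U → v ∈ weinerTargets S u → v ∈ into u
    weiner⊆into {u} {v} u∈ v∈ with ∈-filter⁻ (isNode? S) {v} {weinerCandidates S u} (∈-deduplicate⁻ _≟s_ _ v∈)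
    ... | candidate , isNode with Any.satisfied (∈-concatMap⁻ (letterCandidates u) {xs = allFin (suc σ)} candidate)
    ... | c , there v∈extra = ⊥-elim (no-extra (dec-false (length u ≟ length S) |u|≢n) v∈extra)
      where
      |u|≢n : length u ≢ length S
      |u|≢n |u|≡n = <-irrefl (trans (sym (length-U u∈)) |u|≡n) k<n
      no-extra : ∀ {b : Bool} {y w : Str σ} → b ≡ false → w ∉ (if b then [ y ] else [])
      no-extra refl ()
    ... | c , here refl with find isNode
    ... | r , r∈ , prefix≡ with ∈-map⁻ (rotation S) r∈
    ... | i , i∈ , refl = ∈-filter⁺ (λ x → target x ≟s u)
            (subst (_∈ E) (trans (cong (λ j → take (suc j) (rotation S i)) (sym (length-U u∈))) prefix≡)
                   (E⁺ i (∈-upTo⁻ i∈)))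
            refl

    InF : Str σ → Set
    InF x = All (_≡ target x) (successors S k (source k x)) × All (_≡ source k x) (predecessors S k (target x))

    inF? : ∀ x → Dec (InF x)
    inF? x = all? (_≟s target x) (successors S k (source k x)) ×-dec all? (_≟s source k x) (predecessors S k (target x))

    siblingsOf : Str σ → List (Str σ)
    siblingsOf v = filter (λ v' → take (length v ∸ 1) v' ≟s take (length v ∸ 1) v) (levelNodes S (length v))

    noSiblings? : ∀ v → Dec (All (_≡ v) (siblingsOf v))
    noSiblings? v = all? (_≟s v) (siblingsOf v)

    shared-target-notInF : ∀ {u v w x} → v ≢ w → v ∈ into u → w ∈ into u → x ∈ into u → inF S k x ≡ false
    shared-target-notInF {u} {v} {w} {x} v≢w v∈ w∈ x∈ = dec-false (inF? x) λ (_ , onePred) →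
      v≢w (edge-ext (proj₁ (into⁻ v∈)) (proj₁ (into⁻ w∈))
        (trans (source≡ onePred v∈) (sym (source≡ onePred w∈)))
        (trans (proj₂ (into⁻ v∈)) (sym (proj₂ (into⁻ w∈)))))
      where
      source≡ : All (_≡ source k x) (predecessors S k (target x)) → ∀ {y} → y ∈ into u → source k y ≡ source k x
      source≡ onePred {y} y∈ = All.lookup onePred (∈-map⁺ (source k)
        (∈-filter⁺ (λ z → target z ≟s target x) (proj₁ (into⁻ y∈))
                   (trans (proj₂ (into⁻ y∈)) (sym (proj₂ (into⁻ x∈))))))

    module Siblings {v : Str σ} (|v| : length v ≡ suc k) where

      sibling⁺ : ∀ {y} → y ∈ E → take k y ≡ take k v → y ∈ siblingsOf v
      sibling⁺ {y} y∈ eq rewrite |v| = ∈-filter⁺ (λ v' → take k v' ≟s take k v) (subst (y ∈_) E≡level y∈) eq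

      sibling⁻ : ∀ {y} → y ∈ siblingsOf v → y ∈ E × take k y ≡ take k v
      sibling⁻ {y} y∈ rewrite |v| with ∈-filter⁻ (λ v' → take k v' ≟s take k v) {y} {levelNodes S (suc k)} y∈
      ... | y∈level , eq = subst (y ∈_) (sym E≡level) y∈level , eq

    sole-inF≡noSiblings : ∀ {u v} → (∀ {x} → x ∈ into u → x ≡ v) → v ∈ into u → inF S k v ≡ noSiblings S v
    sole-inF≡noSiblings {u} {v} sole v∈ = does-⇔ (inF? v) (noSiblings? v) F⇒alone alone⇒F
      where
      v∈E : v ∈ E
      v∈E = proj₁ (into⁻ v∈)
      open Siblings {v} (length-E v∈E)
      F⇒alone : InF v → All (_≡ v) (siblingsOf v)
      F⇒alone (oneSucc , _) = All.tabulate λ {y} y∈ → let (y∈E , eq) = sibling⁻ y∈ in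
        edge-ext y∈E v∈E eq (All.lookup oneSucc (∈-map⁺ target (∈-filter⁺ (λ z → source k z ≟s source k v) y∈E eq)))
      alone⇒F : All (_≡ v) (siblingsOf v) → InF v
      alone⇒F alone = All.tabulate oneSucc , All.tabulate onePred
        where
        oneSucc : ∀ {z} → z ∈ successors S k (source k v) → z ≡ target v
        oneSucc z∈ with ∈-map⁻ target z∈
        ... | y , y∈ , refl with ∈-filter⁻ (λ z → source k z ≟s source k v) {y} {E} y∈
        ... | y∈E , eq = cong target (All.lookup alone (sibling⁺ y∈E eq))
        onePred : ∀ {z} → z ∈ predecessors S k (target v) → z ≡ source k v
        onePred z∈ with ∈-map⁻ (source k) z∈
        ... | y , y∈ , refl with ∈-filter⁻ (λ z → target z ≟s target v) {y} {E} y∈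
        ... | y∈E , eq = cong (source k)
          (sole (∈-filter⁺ (λ z → target z ≟s u) y∈E (trans eq (proj₂ (into⁻ v∈)))))

    edgeCount : Str σ → ℕ
    edgeCount x = if inF S k x then 1 else multiplicity S k x

    sole-into-weight : ∀ {u v x} → u ∈ U → weinerTargets S u ≡ [ v ] → x ∈ into u →
      sum (map edgeCount (into u)) ≡ (if noSiblings S v then 1 else leafCount S u)
    sole-into-weight {u} {v} {x} u∈ weiner≡[v] x∈ = begin
      sum (map edgeCount (into u))
        ≡⟨ cong (sum ∘ map edgeCount) into≡[v] ⟩
      (if inF S k v then 1 else multiplicity S k v) + 0
        ≡⟨ +-identityʳ _ ⟩
      (if inF S k v then 1 else multiplicity S k v)
        ≡⟨ cong₂ (if_then 1 else_) (sole-inF≡noSiblings sole v∈) multiplicity≡ ⟩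
      (if noSiblings S v then 1 else leafCount S u) ∎
      where
      open ≡-Reasoning
      sole : ∀ {y} → y ∈ into u → y ≡ v
      sole {y} y∈ with subst (y ∈_) weiner≡[v] (into⊆weiner u∈ y∈)
      ... | here y≡v = y≡v
      v∈ : v ∈ into u
      v∈ = subst (_∈ into u) (sole x∈) x∈
      into≡[v] : into u ≡ [ v ]
      into≡[v] = unique-singleton (into u) v (into-unique u) sole v∈
      multiplicity≡ : multiplicity S k v ≡ leafCount S u
      multiplicity≡ = trans (sym (+-identityʳ _))
        (trans (cong (sum ∘ map (multiplicity S k)) (sym into≡[v])) (into-multiplicity u∈))

    -- several Weiner-link targets: no edge into u is in F, so all count with
    -- their multiplicity, adding up to |u|
    shared-into-weight : ∀ {u x} → u ∈ U → (∀ v → weinerTargets S u ≢ [ v ]) → x ∈ into u →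
      sum (map edgeCount (into u)) ≡ leafCount S u
    shared-into-weight {u} {x} u∈ notSingleton x∈ =
      trans (sum-map-cong (into u) notInF) (into-multiplicity u∈)
      where
      other : Σ (Str σ) λ w → w ∈ weinerTargets S u × w ≢ x
      other = unique-another (weinerTargets S u) (deduplicate-! _≟s_ _) (into⊆weiner u∈ x∈) notSingleton
      notInF : ∀ {y} → y ∈ into u → edgeCount y ≡ multiplicity S k y
      notInF {y} y∈ = cong (if_then 1 else multiplicity S k y)
        (shared-target-notInF (proj₂ (proj₂ other)) (weiner⊆into u∈ (proj₁ (proj₂ other))) x∈ y∈)

    into-weight : ∀ {u} → u ∈ U → sum (map edgeCount (into u)) ≡ weight S u
    into-weight {u} u∈ with weight-cases S u | into-nonempty u∈
    ... | inj₁ (v , weiner≡[v] , weight≡) | _ , x∈ = trans (sole-into-weight u∈ weiner≡[v] x∈) (sym weight≡)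
    ... | inj₂ (notSingleton , weight≡) | _ , x∈ = trans (shared-into-weight u∈ notSingleton x∈) (sym weight≡)

    theorem : reducedEdgeCount S k ≡ sum (map (weight S) U)
    theorem = begin
      sum (map edgeCount E)                    ≡⟨ sum-by-fibres U (deduplicate-! _≟s_ _) E target∈U ⟩
      sum (map (λ u → sum (map edgeCount (into u))) U) ≡⟨ sum-map-cong U into-weight ⟩
      sum (map (weight S) U)                   ∎
      where
      open ≡-Reasoning
      open Fibres _≟s_ target edgeCount

  -- k = n: all rotations are distinct, so both sides count them
  module AtLength (T : Str σ) (S≡T$ : S ≡ T ++ [ $ ]) ($∉T : $ ∉ T) where

    rotation-injective : ∀ {i j} → i < n → j < n → rotation S i ≡ rotation S j → i ≡ j
    rotation-injective {i} {j} = Delimited.rot-injective $ S T S≡T$ $∉T i j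

    rotations-unique : Unique rots
    rotations-unique = subst Unique (sym (map-upTo (rotation S) n))
      (Unique.applyUpTo⁺₁ (rotation S) n λ i<j j<n eq →
        <-irrefl (rotation-injective (<-trans i<j j<n) j<n eq) i<j)

    rotations-length : ∀ {r} → r ∈ rots → length r ≡ n
    rotations-length r∈ with ∈-map⁻ (rotation S) r∈
    ... | i , i∈ , refl = length-rot S i (<⇒≤ (∈-upTo⁻ i∈))

    take-n-rotations : map (take n) rots ≡ rots
    take-n-rotations = trans (map-cong-local (All.tabulate λ r∈ → take-all n _ (≤-reflexive (rotations-length r∈))))
                             (map-id rots)

    level-n≡rotations : levelNodes S n ≡ rots
    level-n≡rotations = trans (cong (deduplicate _≟s_) take-n-rotations) (deduplicate-unique _≟s_ rots rotations-unique)

    window : ℕ → Str σ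
    window i = take (suc n) (drop i (Zk S n))

    window-prefix : ∀ i → i < n → take n (window i) ≡ rotation S i
    window-prefix i i< = begin
      take n (window i)                 ≡⟨ take-take-≤ (drop i (Zk S n)) (n≤1+n n) ⟩
      take n (drop i (S ++ take n S))   ≡⟨ cong (take n) (drop-++ˡ i S (take n S) (<⇒≤ i<)) ⟩
      take n (drop i S ++ take n S)     ≡⟨ take-++-agree n (drop i S) (take n S) (take i S) (take-prefixes S (m∸n≤m n (length (drop i S))) t≤i) ⟩
      take n (rot S i)                  ≡⟨ take-all n (rot S i) (≤-reflexive (length-rot S i (<⇒≤ i<))) ⟩
      rotation S i                      ∎
      where
      open ≡-Reasoning
      t≤i : n ∸ length (drop i S) ≤ i
      t≤i = ≤-reflexive (trans (cong (n ∸_) (length-drop i S)) (m∸[m∸n]≡n (<⇒≤ i<)))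

    occurrences-unique : Unique (occurrences S n)
    occurrences-unique = subst Unique (sym (map-upTo window n))
      (Unique.applyUpTo⁺₁ window n λ {i} {j} i<j j<n eq → <-irrefl
        (rotation-injective (<-trans i<j j<n) j<n
          (trans (sym (window-prefix i (<-trans i<j j<n))) (trans (cong (take n) eq) (window-prefix j j<n))))
        i<j)

    edgeWords≡occurrences : edgeWords S n ≡ occurrences S n
    edgeWords≡occurrences = deduplicate-unique _≟s_ _ occurrences-unique

    edge-weight-1 : ∀ {x} → x ∈ edgeWords S n → (if inF S n x then 1 else multiplicity S n x) ≡ 1
    edge-weight-1 {x} x∈ = if-then-1 (inF S n x) _
      (count-unique _≟s_ _ occurrences-unique (subst (x ∈_) edgeWords≡occurrences x∈))

    edges-count : reducedEdgeCount S n ≡ n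
    edges-count = begin
      reducedEdgeCount S n                   ≡⟨ sum-map-cong (edgeWords S n) edge-weight-1 ⟩
      sum (map (λ _ → 1) (edgeWords S n))    ≡⟨ sum-map-1 (edgeWords S n) ⟩
      length (edgeWords S n)                 ≡⟨ cong length edgeWords≡occurrences ⟩
      length (occurrences S n)               ≡⟨ trans (length-map window (upTo n)) (length-upTo n) ⟩
      n                                      ∎
      where open ≡-Reasoning

    leafCount-1 : ∀ {u} → u ∈ levelNodes S n → leafCount S u ≡ 1
    leafCount-1 {u} u∈ = begin
      leafCount S u                              ≡⟨ cong (λ j → length (filter (λ r → take j r ≟s u) rots))
                                                         (rotations-length u∈rots) ⟩
      length (filter (λ r → take n r ≟s u) rots) ≡⟨ length-filter-map (_≟s u) (take n) rots ⟨
      length (filter (_≟s u) (map (take n) rots)) ≡⟨ cong (length ∘ filter (_≟s u)) take-n-rotations ⟩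
      length (filter (_≟s u) rots)                ≡⟨ count-unique _≟s_ rots rotations-unique u∈rots ⟩
      1                                          ∎
      where
      open ≡-Reasoning
      u∈rots : u ∈ rots
      u∈rots = subst (u ∈_) level-n≡rotations u∈

    weight-1 : ∀ {u} → u ∈ levelNodes S n → weight S u ≡ 1
    weight-1 {u} u∈ with weight-cases S u
    ... | inj₁ (v , _ , weight≡) = trans weight≡ (if-then-1 (noSiblings S v) _ (leafCount-1 u∈))
    ... | inj₂ (_ , weight≡) = trans weight≡ (leafCount-1 u∈)

    nodes-weight : sum (map (weight S) (levelNodes S n)) ≡ n
    nodes-weight = begin
      sum (map (weight S) (levelNodes S n))      ≡⟨ sum-map-cong _ weight-1 ⟩
      sum (map (λ _ → 1) (levelNodes S n))       ≡⟨ sum-map-1 (levelNodes S n) ⟩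
      length (levelNodes S n)                    ≡⟨ cong length level-n≡rotations ⟩
      length rots                                ≡⟨ trans (length-map (rotation S) (upTo n)) (length-upTo n) ⟩
      n                                          ∎
      where open ≡-Reasoning

    theorem : reducedEdgeCount S n ≡ sum (map (weight S) (levelNodes S n))
    theorem = trans edges-count (sym nodes-weight)

lemma3 : (σ : ℕ) (S : Str σ) → DollarTerminated S →
    (k : ℕ) → 1 ≤ k → k ≤ length S →
    reducedEdgeCount S k ≡ sum (map (weight S) (levelNodes S k))
lemma3 σ S (T , S≡T$ , $∉T) k 1≤k k≤n with m≤n⇒m<n∨m≡n k≤n
... | inj₁ k<n = EdgeCount.BelowLength.theorem S k 1≤k k<n
... | inj₂ refl = EdgeCount.AtLength.theorem S T S≡T$ $∉T
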